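{- Let $a<b$ be coprime positive integers and let $\pi$ be any noncrossing partition of $[b-1]$. Then $\sum_{B\in\pi}\mathrm{rank}^{\pi}_{a,b}(B)\ge a$.
   Context: Let $[b-1]=\{1,\dots,b-1\}$. A set partition is noncrossing if there are no $i<j<k<\ell$ with $i\sim k$, $j\sim\ell$, $i\not\sim j$. Rank: for a noncrossing partition $\pi$ of $[b-1]$, order its blocks by $B'\preceq B$ iff $[\min B',\max B']\subseteq[\min B,\max B]$; the integers $\mathrm{rank}^{\pi}_{a,b}(B)$ are the unique integers with $\sum_{B'\preceq B}\mathrm{rank}^{\pi}_{a,b}(B')=\lceil(\max B-\min B+1)\frac ab\rceil$ for every block $B$ of $\pi$. -}

module Defs where

open import Data.Nat using (ℕ; zero; suc; _+_; _*_; _∸_; _≤_; _<_; _⊓_; _⊔_)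
open import Data.Nat.DivMod using (_/_)
open import Data.Integer as ℤ using (ℤ)
open import Data.List using (List; []; _∷_; foldr; map; length; filter; lookup; allFin)
open import Data.List.Membership.Propositional using (_∈_)
open import Data.Fin using (Fin)
open import Data.Product using (Σ; ∃; _×_; _,_)
open import Relation.Nullary using (¬_)
open import Relation.Nullary.Decidable using (_×-dec_)
open import Relation.Binary.PropositionalEquality using (_≡_)
import Data.Nat.Properties as ℕP

-- ceiling of n / d (d > 0); ceilDiv n 0 = 0 is a junk value never used
ceilDiv : ℕ → ℕ → ℕ
ceilDiv n zero = 0
ceilDiv n (suc d) = (n + d) / suc d

-- a block is a finite (nonempty) list of positive integers
Block : Set
Block = List ℕ

blockMin : Block → ℕ
blockMin [] = 0
blockMin (x ∷ xs) = foldr _⊓_ x xs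

blockMax : Block → ℕ
blockMax [] = 0
blockMax (x ∷ xs) = foldr _⊔_ x xs

record IsSetPartition (n : ℕ) (π : List Block) : Set where
  field
    nonempty : ∀ (i : Fin (length π)) → Σ ℕ (λ x → x ∈ lookup π i)
    inRange  : ∀ (i : Fin (length π)) (x : ℕ) → x ∈ lookup π i → 1 ≤ x × x ≤ n
    covers   : ∀ (x : ℕ) → 1 ≤ x → x ≤ n → Σ (Fin (length π)) (λ i → x ∈ lookup π i)
    disjoint : ∀ (i j : Fin (length π)) (x : ℕ) → x ∈ lookup π i → x ∈ lookup π j → i ≡ j

_∼[_]_ : ℕ → List Block → ℕ → Set
x ∼[ π ] y = Σ (Fin (length π)) (λ i → x ∈ lookup π i × y ∈ lookup π i)

IsNoncrossing : List Block → Set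
IsNoncrossing π = ∀ (i j k l : ℕ) → i < j → j < k → k < l →
  i ∼[ π ] k → j ∼[ π ] l → i ∼[ π ] j

record IsNCPartition (n : ℕ) (π : List Block) : Set where
  field
    partition   : IsSetPartition n π
    noncrossing : IsNoncrossing π

_⪯_ : Block → Block → Set
B' ⪯ B = blockMin B ≤ blockMin B' × blockMax B' ≤ blockMax B

sumℤ : List ℤ → ℤ
sumℤ = foldr ℤ._+_ (ℤ.+ 0)

below : (π : List Block) → Fin (length π) → List (Fin (length π))
below π i = filter (λ j → (blockMin (lookup π i) ℕP.≤? blockMin (lookup π j))
                          ×-dec (blockMax (lookup π j) ℕP.≤? blockMax (lookup π i)))
                   (allFin (length π))

-- r satisfies the defining equations of rank^π_{a,b}:
--   Σ_{B' ⪯ B} r(B') = ⌈ (max B − min B + 1) · a / b ⌉   for every block B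
IsRank : (a b : ℕ) (π : List Block) → (Fin (length π) → ℤ) → Set
IsRank a b π r = ∀ (i : Fin (length π)) →
  sumℤ (map r (below π i))
    ≡ ℤ.+ ceilDiv ((blockMax (lookup π i) ∸ blockMin (lookup π i) + 1) * a) b

-- By noncrossingness the intervals [min B, max B] of the blocks form a laminar family, so every
-- block lies below exactly one ⪯-maximal block. Grouping the blocks by their maximal block, the
-- defining equations of the rank say that the total rank is Σ ⌈|I| a / b⌉ over the intervals I of
-- the maximal blocks. These intervals cover [b-1], so the total rank times b is at least
-- (b-1) a, and since a < b this forces the total rank to be at least a.
module Submission where

open import Algebra.Bundles using (Semiring)
import Algebra.Properties.Semiring.Sum as SemiringSum
open import Data.Fin using (Fin; zero; suc; toℕ) renaming (_≟_ to _≟ᶠ_)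
import Data.Fin.Properties as Finₚ
open import Data.Integer as ℤ using (ℤ; +_; _≥_)
import Data.Integer.Properties as ℤₚ
open import Data.List using (List; []; _∷_; map; filter; tabulate; length; lookup; allFin)
open import Data.List.Membership.Propositional using (_∈_; lose)
open import Data.List.Membership.Propositional.Properties using (foldr-selective)
open import Data.List.Properties using (foldr-preservesᵒ)
open import Data.List.Relation.Unary.Any using (Any; here; there)
open import Data.Nat as ℕ using (ℕ; zero; suc; _∸_; _⊔_; _≤_; _<_; s≤s; z≤n)
open import Data.Nat.Coprimality using (Coprime)
open import Data.Nat.DivMod using (_%_; m≡m%n+[m/n]*n; m%n<n)
open import Data.Nat.Induction using (<-wellFounded)
import Data.Nat.Properties as ℕₚ
open import Data.Product using (Σ; _×_; _,_; proj₂)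
open import Data.Sum using (_⊎_; inj₁; inj₂)
open import Function using (_∘_; id; _on_)
open import Induction.WellFounded using (Acc; acc)
import Relation.Binary.Construct.On as On
open import Relation.Nullary using (¬_; Dec; yes; no; contradiction; _×-dec_; _→-dec_; ¬?)
open import Relation.Unary using (Decidable)
open import Relation.Binary.PropositionalEquality
  using (_≡_; _≢_; refl; sym; trans; cong; cong₂; subst; module ≡-Reasoning)

open import Defs

blockMin-∈ : ∀ {B x} → x ∈ B → blockMin B ∈ B
blockMin-∈ {y ∷ ys} _ with foldr-selective ℕₚ.⊓-sel y ys
... | inj₁ eq = here eq
... | inj₂ ∈ys = there ∈ys

blockMax-∈ : ∀ {B x} → x ∈ B → blockMax B ∈ B
blockMax-∈ {y ∷ ys} _ with foldr-selective ℕₚ.⊔-sel y ys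
... | inj₁ eq = here eq
... | inj₂ ∈ys = there ∈ys

blockMin-≤ : ∀ {B x} → x ∈ B → blockMin B ≤ x
blockMin-≤ {y ∷ ys} {x} x∈B = foldr-preservesᵒ ⊓-≤ y ys (from x∈B)
  where
  ⊓-≤ : ∀ u v → u ≤ x ⊎ v ≤ x → u ℕ.⊓ v ≤ x
  ⊓-≤ u v (inj₁ u≤x) = ℕₚ.m≤n⇒m⊓o≤n v u≤x
  ⊓-≤ u v (inj₂ v≤x) = ℕₚ.m≤n⇒o⊓m≤n u v≤x
  from : x ∈ y ∷ ys → y ≤ x ⊎ Any (_≤ x) ys
  from (here refl) = inj₁ ℕₚ.≤-refl
  from (there x∈ys) = inj₂ (lose x∈ys ℕₚ.≤-refl)

≤-blockMax : ∀ {B x} → x ∈ B → x ≤ blockMax B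
≤-blockMax {y ∷ ys} {x} x∈B = foldr-preservesᵒ ≤-⊔ y ys (from x∈B)
  where
  ≤-⊔ : ∀ u v → x ≤ u ⊎ x ≤ v → x ≤ u ⊔ v
  ≤-⊔ u v (inj₁ x≤u) = ℕₚ.m≤n⇒m≤n⊔o v x≤u
  ≤-⊔ u v (inj₂ x≤v) = ℕₚ.m≤n⇒m≤o⊔n u x≤v
  from : x ∈ y ∷ ys → x ≤ y ⊎ Any (x ≤_) ys
  from (here refl) = inj₁ ℕₚ.≤-refl
  from (there x∈ys) = inj₂ (lose x∈ys ℕₚ.≤-refl)

module Indicator {c ℓ} (S : Semiring c ℓ) where
  open Semiring S hiding (zero) renaming (refl to ≈-refl; sym to ≈-sym; trans to ≈-trans)
  open SemiringSum S
  open import Relation.Binary.Reasoning.Setoid setoid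

  𝟙[_] : ∀ {p} {P : Set p} → Dec P → Carrier
  𝟙[ yes _ ] = 1#
  𝟙[ no _ ] = 0#

  𝟙-yes : ∀ {p} {P : Set p} (P? : Dec P) → P → 𝟙[ P? ] ≈ 1#
  𝟙-yes (yes _) _ = ≈-refl
  𝟙-yes (no ¬p) p = contradiction p ¬p

  𝟙-no : ∀ {p} {P : Set p} (P? : Dec P) → ¬ P → 𝟙[ P? ] ≈ 0#
  𝟙-no (yes p) ¬p = contradiction p ¬p
  𝟙-no (no _) _ = ≈-refl

  𝟙-×-dec : ∀ {p q} {P : Set p} {Q : Set q} (P? : Dec P) (Q? : Dec Q) →
            𝟙[ P? ×-dec Q? ] ≈ 𝟙[ P? ] * 𝟙[ Q? ]
  𝟙-×-dec (yes _) (yes _) = ≈-sym (*-identityˡ 1#)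
  𝟙-×-dec (yes _) (no _) = ≈-sym (zeroʳ 1#)
  𝟙-×-dec (no _) _ = ≈-sym (zeroˡ _)

  ∑𝟙-unique : ∀ {n q} {Q : Fin n → Set q} (Q? : ∀ i → Dec (Q i)) {i₀} →
              Q i₀ → (∀ i → Q i → i ≡ i₀) → ∑[ i < n ] 𝟙[ Q? i ] ≈ 1#
  ∑𝟙-unique {suc n} Q? {zero} q₀ unique = begin
    𝟙[ Q? zero ] + ∑[ i < n ] 𝟙[ Q? (suc i) ]  ≈⟨ +-cong (𝟙-yes (Q? zero) q₀) (sum-cong-≋ others) ⟩
    1# + ∑[ i < n ] 0#                        ≈⟨ +-congˡ (sum-replicate-zero n) ⟩
    1# + 0#                                   ≈⟨ +-identityʳ 1# ⟩
    1#                                        ∎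
    where
    others : ∀ i → 𝟙[ Q? (suc i) ] ≈ 0#
    others i = 𝟙-no (Q? (suc i)) (λ q → Finₚ.0≢1+n (sym (unique (suc i) q)))
  ∑𝟙-unique {suc n} Q? {suc i₀} q₀ unique = begin
    𝟙[ Q? zero ] + ∑[ i < n ] 𝟙[ Q? (suc i) ]  ≈⟨ +-cong (𝟙-no (Q? zero) (Finₚ.0≢1+n ∘ unique zero)) rest ⟩
    0# + 1#                                   ≈⟨ +-identityˡ 1# ⟩
    1#                                        ∎
    where
    rest : ∑[ i < n ] 𝟙[ Q? (suc i) ] ≈ 1#
    rest = ∑𝟙-unique (Q? ∘ suc) q₀ (λ i q → Finₚ.suc-injective (unique (suc i) q))

  ∑-regroup : ∀ {m n q} {Q : Fin m → Fin n → Set q} (Q? : ∀ i j → Dec (Q i j)) →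
              (∀ i → Σ (Fin n) λ j₀ → Q i j₀ × (∀ j → Q i j → j ≡ j₀)) →
              (f : Fin m → Carrier) →
              ∑[ i < m ] f i ≈ ∑[ j < n ] ∑[ i < m ] (𝟙[ Q? i j ] * f i)
  ∑-regroup {m} {n} Q? unique f = begin
    ∑[ i < m ] f i                                ≈⟨ sum-cong-≋ weigh ⟩
    ∑[ i < m ] ((∑[ j < n ] 𝟙[ Q? i j ]) * f i)   ≈⟨ sum-cong-≋ (λ i → *-distribʳ-sum (f i) (λ j → 𝟙[ Q? i j ])) ⟩
    ∑[ i < m ] ∑[ j < n ] (𝟙[ Q? i j ] * f i)     ≈⟨ ∑-comm (λ i j → 𝟙[ Q? i j ] * f i) ⟩
    ∑[ j < n ] ∑[ i < m ] (𝟙[ Q? i j ] * f i)     ∎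
    where
    weigh : ∀ i → f i ≈ (∑[ j < n ] 𝟙[ Q? i j ]) * f i
    weigh i with unique i
    ... | j₀ , q₀ , unique-j₀ =
      ≈-trans (≈-sym (*-identityˡ (f i))) (*-congʳ (≈-sym (∑𝟙-unique (Q? i) q₀ unique-j₀)))

module ℕΣ = SemiringSum ℕₚ.+-*-semiring
module ℤΣ = SemiringSum ℤₚ.+-*-semiring
module ℕ𝟙 = Indicator ℕₚ.+-*-semiring
module ℤ𝟙 = Indicator ℤₚ.+-*-semiring

∑-mono-≤ : ∀ {n} {f g : Fin n → ℕ} → (∀ i → f i ≤ g i) → ℕΣ.sum f ≤ ℕΣ.sum g
∑-mono-≤ {zero} f≤g = z≤n
∑-mono-≤ {suc n} f≤g = ℕₚ.+-mono-≤ (f≤g zero) (∑-mono-≤ (f≤g ∘ suc))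

≤-∑ : ∀ {n} (f : Fin n → ℕ) i → f i ≤ ℕΣ.sum f
≤-∑ f zero = ℕₚ.m≤m+n _ _
≤-∑ f (suc i) = ℕₚ.≤-trans (≤-∑ (f ∘ suc) i) (ℕₚ.m≤n+m _ _)

∑-const-1 : ∀ n → ℕΣ.∑[ i < n ] 1 ≡ n
∑-const-1 zero = refl
∑-const-1 (suc n) = cong suc (∑-const-1 n)

pos-∑ : ∀ {n} (f : Fin n → ℕ) → + ℕΣ.sum f ≡ ℤΣ.sum (+_ ∘ f)
pos-∑ {zero} f = refl
pos-∑ {suc n} f = trans (ℤₚ.pos-+ (f zero) _) (cong (ℤ._+_ (+ f zero)) (pos-∑ (f ∘ suc)))

pos-𝟙-* : ∀ {p} {P : Set p} (P? : Dec P) n → + (ℕ𝟙.𝟙[ P? ] ℕ.* n) ≡ ℤ𝟙.𝟙[ P? ] ℤ.* + n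
pos-𝟙-* (yes _) n = ℤₚ.pos-* 1 n
pos-𝟙-* (no _) n = ℤₚ.pos-* 0 n

sumℤ-map-tabulate : ∀ {a n} {A : Set a} (f : A → ℤ) (g : Fin n → A) →
                    sumℤ (map f (tabulate g)) ≡ ℤΣ.sum (f ∘ g)
sumℤ-map-tabulate {n = zero} f g = refl
sumℤ-map-tabulate {n = suc n} f g = cong (ℤ._+_ (f (g zero))) (sumℤ-map-tabulate f (g ∘ suc))

sumℤ-map-filter : ∀ {a p} {A : Set a} {P : A → Set p} (P? : Decidable P) (f : A → ℤ) xs →
                  sumℤ (map f (filter P? xs)) ≡ sumℤ (map (λ x → ℤ𝟙.𝟙[ P? x ] ℤ.* f x) xs)
sumℤ-map-filter P? f [] = refl
sumℤ-map-filter P? f (x ∷ xs) with P? x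
... | yes _ = cong₂ ℤ._+_ (sym (ℤₚ.*-identityˡ (f x))) (sumℤ-map-filter P? f xs)
... | no _ = begin
  sumℤ (map f (filter P? xs))                           ≡⟨ sumℤ-map-filter P? f xs ⟩
  rest                                                  ≡⟨ ℤₚ.+-identityˡ rest ⟨
  + 0 ℤ.+ rest                                          ≡⟨ cong (ℤ._+ rest) (ℤₚ.*-zeroˡ (f x)) ⟨
  + 0 ℤ.* f x ℤ.+ rest                                  ∎
  where
  open ≡-Reasoning
  rest : ℤ
  rest = sumℤ (map (λ x → ℤ𝟙.𝟙[ P? x ] ℤ.* f x) xs)

≤-ceilDiv-* : ∀ m n → m ≤ ceilDiv m (suc n) ℕ.* suc n
≤-ceilDiv-* m n = ℕₚ.+-cancelʳ-≤ n m _ (begin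
  m ℕ.+ n                                        ≡⟨ m≡m%n+[m/n]*n (m ℕ.+ n) (suc n) ⟩
  (m ℕ.+ n) % suc n ℕ.+ ceilDiv m (suc n) ℕ.* suc n ≤⟨ ℕₚ.+-monoˡ-≤ _ (ℕₚ.<⇒≤pred (m%n<n (m ℕ.+ n) (suc n))) ⟩
  n ℕ.+ ceilDiv m (suc n) ℕ.* suc n               ≡⟨ ℕₚ.+-comm n _ ⟩
  ceilDiv m (suc n) ℕ.* suc n ℕ.+ n               ∎)
  where open ℕₚ.≤-Reasoning

between? : ∀ l r x → Dec (l ≤ x × x ≤ r)
between? l r x = (l ℕ.≤? x) ×-dec (x ℕ.≤? r)

∑-between : ∀ N s l r → ℕΣ.∑[ i < N ] ℕ𝟙.𝟙[ between? l r (s ℕ.+ toℕ i) ] ≤ suc r ∸ (s ⊔ l)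
∑-between zero s l r = z≤n
∑-between (suc N) s l r = begin
  inside (s ℕ.+ 0) ℕ.+ ℕΣ.∑[ i < N ] inside (s ℕ.+ suc (toℕ i))
    ≡⟨ cong₂ ℕ._+_ (cong inside (ℕₚ.+-identityʳ s)) (ℕΣ.sum-cong-≗ {N} (cong inside ∘ ℕₚ.+-suc s ∘ toℕ)) ⟩
  inside s ℕ.+ ℕΣ.∑[ i < N ] inside (suc s ℕ.+ toℕ i)
    ≤⟨ ℕₚ.+-monoʳ-≤ (inside s) (∑-between N (suc s) l r) ⟩
  inside s ℕ.+ (suc r ∸ (suc s ⊔ l))
    ≤⟨ step (between? l r s) ⟩
  suc r ∸ (s ⊔ l) ∎
  where
  open ℕₚ.≤-Reasoning
  inside : ℕ → ℕ
  inside x = ℕ𝟙.𝟙[ between? l r x ]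
  step : (s∈? : Dec (l ≤ s × s ≤ r)) → ℕ𝟙.𝟙[ s∈? ] ℕ.+ (suc r ∸ (suc s ⊔ l)) ≤ suc r ∸ (s ⊔ l)
  step (yes (l≤s , s≤r)) = ℕₚ.≤-reflexive (begin-equality
    suc (suc r ∸ (suc s ⊔ l)) ≡⟨ cong (λ t → suc (suc r ∸ t)) (ℕₚ.m≥n⇒m⊔n≡m (ℕₚ.m≤n⇒m≤1+n l≤s)) ⟩
    suc (r ∸ s)               ≡⟨ ℕₚ.+-∸-assoc 1 s≤r ⟨
    suc r ∸ s                 ≡⟨ cong (suc r ∸_) (ℕₚ.m≥n⇒m⊔n≡m l≤s) ⟨
    suc r ∸ (s ⊔ l)           ∎)
  step (no _) = ℕₚ.∸-monoʳ-≤ (suc r) (ℕₚ.⊔-monoˡ-≤ l (ℕₚ.n≤1+n s))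

a≤d⇒d*a≤t*[1+d]⇒a≤t : ∀ {a d t} → a ≤ d → d ℕ.* a ≤ t ℕ.* suc d → a ≤ t
a≤d⇒d*a≤t*[1+d]⇒a≤t {a} {d} {t} a≤d da≤t[1+d] = ℕₚ.≮⇒≥ (λ t<a → ℕₚ.<⇒≱ (s≤s a≤d) (1+d≤a t<a))
  where
  open ℕₚ.≤-Reasoning
  1+d≤a : t < a → suc d ≤ a
  1+d≤a t<a = ℕₚ.+-cancelʳ-≤ (a ℕ.* d) (suc d) a (begin
    suc d ℕ.+ a ℕ.* d     ≡⟨ cong (suc d ℕ.+_) (ℕₚ.*-comm a d) ⟩
    suc d ℕ.+ d ℕ.* a     ≤⟨ ℕₚ.+-monoʳ-≤ (suc d) da≤t[1+d] ⟩
    suc t ℕ.* suc d       ≤⟨ ℕₚ.*-monoˡ-≤ (suc d) t<a ⟩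
    a ℕ.* suc d           ≡⟨ ℕₚ.*-suc a d ⟩
    a ℕ.+ a ℕ.* d         ∎)

module NoncrossingPartition {d : ℕ} {π : List Block} (isNC : IsNCPartition d π) where
  open IsNCPartition isNC
  open IsSetPartition partition

  n : ℕ
  n = length π

  L R : Fin n → ℕ
  L i = blockMin (lookup π i)
  R i = blockMax (lookup π i)

  L-∈ : ∀ i → L i ∈ lookup π i
  L-∈ i = blockMin-∈ (proj₂ (nonempty i))

  R-∈ : ∀ i → R i ∈ lookup π i
  R-∈ i = blockMax-∈ (proj₂ (nonempty i))

  L≤R : ∀ i → L i ≤ R i
  L≤R i = ℕₚ.≤-trans (blockMin-≤ (L-∈ i)) (≤-blockMax (L-∈ i))

  L≡⇒≡ : ∀ {i j} → L i ≡ L j → i ≡ j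
  L≡⇒≡ {i} {j} eq = disjoint i j (L i) (L-∈ i) (subst (_∈ lookup π j) (sym eq) (L-∈ j))

  -- The only input from noncrossingness: endpoint intervals never properly overlap.
  laminar : ∀ i j → L i ≤ L j → L j ≤ R i → R j ≤ R i
  laminar i j Li≤Lj Lj≤Ri with R j ℕ.≤? R i
  ... | yes Rj≤Ri = Rj≤Ri
  ... | no Rj≰Ri = ℕₚ.≤-reflexive (cong R (sym i≡j))
    where
    i≡j : i ≡ j
    i≡j with L i ℕₚ.≟ L j | L j ℕₚ.≟ R i
    ... | yes Li≡Lj | _ = L≡⇒≡ Li≡Lj
    ... | no _ | yes Lj≡Ri = disjoint i j (R i) (R-∈ i) (subst (_∈ lookup π j) Lj≡Ri (L-∈ j))
    ... | no Li≢Lj | no Lj≢Ri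
      with noncrossing (L i) (L j) (R i) (R j) (ℕₚ.≤∧≢⇒< Li≤Lj Li≢Lj) (ℕₚ.≤∧≢⇒< Lj≤Ri Lj≢Ri)
             (ℕₚ.≰⇒> Rj≰Ri) (i , L-∈ i , R-∈ i) (j , L-∈ j , R-∈ j)
    ... | k , Li∈k , Lj∈k = trans (disjoint i k (L i) (L-∈ i) Li∈k) (disjoint k j (L j) Lj∈k (L-∈ j))

  _⊑_ : Fin n → Fin n → Set
  i ⊑ j = lookup π i ⪯ lookup π j

  _⊑?_ : ∀ i j → Dec (i ⊑ j)
  i ⊑? j = (L j ℕ.≤? L i) ×-dec (R i ℕ.≤? R j)

  ⊑-trans : ∀ {i j k} → i ⊑ j → j ⊑ k → i ⊑ k
  ⊑-trans (Lj≤Li , Ri≤Rj) (Lk≤Lj , Rj≤Rk) = ℕₚ.≤-trans Lk≤Lj Lj≤Li , ℕₚ.≤-trans Ri≤Rj Rj≤Rk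

  IsMaximal : Fin n → Set
  IsMaximal m = ∀ k → m ⊑ k → k ≡ m

  isMaximal? : ∀ m → Dec (IsMaximal m)
  isMaximal? m = Finₚ.all? (λ k → (m ⊑? k) →-dec (k ≟ᶠ m))

  maximal-unique : ∀ {j m₁ m₂} → IsMaximal m₁ → IsMaximal m₂ → j ⊑ m₁ → j ⊑ m₂ → m₁ ≡ m₂
  maximal-unique {j} {m₁} {m₂} max₁ max₂ (L₁≤Lj , Rj≤R₁) (L₂≤Lj , Rj≤R₂)
    with ℕₚ.≤-total (L m₁) (L m₂)
  ... | inj₁ L₁≤L₂ = max₂ m₁ (L₁≤L₂ , laminar m₁ m₂ L₁≤L₂ L₂≤R₁)
    where
    L₂≤R₁ : L m₂ ≤ R m₁
    L₂≤R₁ = ℕₚ.≤-trans L₂≤Lj (ℕₚ.≤-trans (L≤R j) Rj≤R₁)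
  ... | inj₂ L₂≤L₁ = sym (max₁ m₂ (L₂≤L₁ , laminar m₂ m₁ L₂≤L₁ L₁≤R₂))
    where
    L₁≤R₂ : L m₁ ≤ R m₂
    L₁≤R₂ = ℕₚ.≤-trans L₁≤Lj (ℕₚ.≤-trans (L≤R j) Rj≤R₂)

  slack : Fin n → ℕ
  slack j = L j ℕ.+ (d ∸ R j)

  slack-< : ∀ {j k} → j ⊑ k → k ≢ j → slack k < slack j
  slack-< {j} {k} (Lk≤Lj , Rj≤Rk) k≢j =
    ℕₚ.+-mono-<-≤ (ℕₚ.≤∧≢⇒< Lk≤Lj (k≢j ∘ L≡⇒≡)) (ℕₚ.∸-monoʳ-≤ d Rj≤Rk)

  maximal-above : ∀ j → Σ (Fin n) λ m → IsMaximal m × j ⊑ m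
  maximal-above j = go j (On.wellFounded slack <-wellFounded j)
    where
    go : ∀ j → Acc (_<_ on slack) j → Σ (Fin n) λ m → IsMaximal m × j ⊑ m
    go j (acc rec) with Finₚ.any? (λ k → (j ⊑? k) ×-dec ¬? (k ≟ᶠ j))
    ... | yes (k , j⊑k , k≢j) =
      let m , max-m , k⊑m = go k (rec (slack-< j⊑k k≢j)) in m , max-m , ⊑-trans j⊑k k⊑m
    ... | no ∄k = j , max-j , ℕₚ.≤-refl , ℕₚ.≤-refl
      where
      max-j : IsMaximal j
      max-j k j⊑k with k ≟ᶠ j
      ... | yes k≡j = k≡j
      ... | no k≢j = contradiction (k , j⊑k , k≢j) ∄k

  len : Fin n → ℕ
  len m = R m ∸ L m ℕ.+ 1

  covered-by-maximal : ∀ x → 1 ≤ x → x ≤ d → Σ (Fin n) λ m → IsMaximal m × L m ≤ x × x ≤ R m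
  covered-by-maximal x 1≤x x≤d with covers x 1≤x x≤d
  ... | i , x∈i with maximal-above i
  ... | m , max-m , Lm≤Li , Ri≤Rm =
    m , max-m , ℕₚ.≤-trans Lm≤Li (blockMin-≤ x∈i) , ℕₚ.≤-trans (≤-blockMax x∈i) Ri≤Rm

  ∑-points-≤-len : ∀ m → ℕΣ.∑[ x < d ] ℕ𝟙.𝟙[ between? (L m) (R m) (suc (toℕ x)) ] ≤ len m
  ∑-points-≤-len m = begin
    ℕΣ.∑[ x < d ] ℕ𝟙.𝟙[ between? (L m) (R m) (suc (toℕ x)) ] ≤⟨ ∑-between d 1 (L m) (R m) ⟩
    suc (R m) ∸ (1 ⊔ L m)                                   ≤⟨ ℕₚ.∸-monoʳ-≤ (suc (R m)) (ℕₚ.m≤n⊔m 1 (L m)) ⟩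
    suc (R m) ∸ L m                                         ≡⟨ ℕₚ.+-∸-assoc 1 (L≤R m) ⟩
    suc (R m ∸ L m)                                         ≡⟨ ℕₚ.+-comm 1 _ ⟩
    len m                                                   ∎
    where open ℕₚ.≤-Reasoning

  -- Count the points of [d] once each, through the maximal interval containing them.
  d≤∑-maximal-len : d ≤ ℕΣ.∑[ m < n ] (ℕ𝟙.𝟙[ isMaximal? m ] ℕ.* len m)
  d≤∑-maximal-len = begin
    d                                                      ≡⟨ ∑-const-1 d ⟨
    ℕΣ.∑[ x < d ] 1                                         ≤⟨ ∑-mono-≤ covered ⟩
    ℕΣ.∑[ x < d ] ℕΣ.∑[ m < n ] (χ m ℕ.* inside m x)        ≡⟨ ℕΣ.∑-comm (λ x m → χ m ℕ.* inside m x) ⟩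
    ℕΣ.∑[ m < n ] ℕΣ.∑[ x < d ] (χ m ℕ.* inside m x)        ≡⟨ ℕΣ.sum-cong-≗ (λ m → ℕΣ.*-distribˡ-sum (χ m) (inside m)) ⟨
    ℕΣ.∑[ m < n ] (χ m ℕ.* ℕΣ.∑[ x < d ] inside m x)        ≤⟨ ∑-mono-≤ (λ m → ℕₚ.*-monoʳ-≤ (χ m) (∑-points-≤-len m)) ⟩
    ℕΣ.∑[ m < n ] (χ m ℕ.* len m)                           ∎
    where
    open ℕₚ.≤-Reasoning
    χ : Fin n → ℕ
    χ m = ℕ𝟙.𝟙[ isMaximal? m ]
    inside : Fin n → Fin d → ℕ
    inside m x = ℕ𝟙.𝟙[ between? (L m) (R m) (suc (toℕ x)) ]
    covered : ∀ x → 1 ≤ ℕΣ.∑[ m < n ] (χ m ℕ.* inside m x)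
    covered x with covered-by-maximal (suc (toℕ x)) (s≤s z≤n) (Finₚ.toℕ<n x)
    ... | m , max-m , x∈m = ℕₚ.≤-trans (ℕₚ.≤-reflexive (sym χ*inside≡1)) (≤-∑ (λ m → χ m ℕ.* inside m x) m)
      where
      χ*inside≡1 : χ m ℕ.* inside m x ≡ 1
      χ*inside≡1 = cong₂ ℕ._*_ (ℕ𝟙.𝟙-yes (isMaximal? m) max-m) (ℕ𝟙.𝟙-yes (between? _ _ _) x∈m)

  maximalCeilSum : ℕ → ℕ → ℕ
  maximalCeilSum a b = ℕΣ.∑[ m < n ] (ℕ𝟙.𝟙[ isMaximal? m ] ℕ.* ceilDiv (len m ℕ.* a) b)

  d*a≤maximalCeilSum*[1+d] : ∀ a → d ℕ.* a ≤ maximalCeilSum a (suc d) ℕ.* suc d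
  d*a≤maximalCeilSum*[1+d] a = begin
    d ℕ.* a                                             ≤⟨ ℕₚ.*-monoˡ-≤ a d≤∑-maximal-len ⟩
    ℕΣ.∑[ m < n ] (χ m ℕ.* len m) ℕ.* a                 ≡⟨ ℕΣ.*-distribʳ-sum a (λ m → χ m ℕ.* len m) ⟩
    ℕΣ.∑[ m < n ] (χ m ℕ.* len m ℕ.* a)                 ≤⟨ ∑-mono-≤ term-bound ⟩
    ℕΣ.∑[ m < n ] (χ m ℕ.* c m ℕ.* suc d)               ≡⟨ ℕΣ.*-distribʳ-sum (suc d) (λ m → χ m ℕ.* c m) ⟨
    maximalCeilSum a (suc d) ℕ.* suc d                  ∎
    where
    open ℕₚ.≤-Reasoning
    χ c : Fin n → ℕ
    χ m = ℕ𝟙.𝟙[ isMaximal? m ]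
    c m = ceilDiv (len m ℕ.* a) (suc d)
    term-bound : ∀ m → χ m ℕ.* len m ℕ.* a ≤ χ m ℕ.* c m ℕ.* suc d
    term-bound m = begin
      χ m ℕ.* len m ℕ.* a         ≡⟨ ℕₚ.*-assoc (χ m) (len m) a ⟩
      χ m ℕ.* (len m ℕ.* a)       ≤⟨ ℕₚ.*-monoʳ-≤ (χ m) (≤-ceilDiv-* (len m ℕ.* a) d) ⟩
      χ m ℕ.* (c m ℕ.* suc d)     ≡⟨ ℕₚ.*-assoc (χ m) (c m) (suc d) ⟨
      χ m ℕ.* c m ℕ.* suc d       ∎

  module _ (a b : ℕ) (rank : Fin n → ℤ) (isRank : IsRank a b π rank) where

    ∑-rank-below : ∀ m → ℤΣ.∑[ j < n ] (ℤ𝟙.𝟙[ j ⊑? m ] ℤ.* rank j) ≡ + ceilDiv (len m ℕ.* a) b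
    ∑-rank-below m = begin
      ℤΣ.∑[ j < n ] (ℤ𝟙.𝟙[ j ⊑? m ] ℤ.* rank j)       ≡⟨ sumℤ-map-tabulate (λ j → ℤ𝟙.𝟙[ j ⊑? m ] ℤ.* rank j) id ⟨
      sumℤ (map (λ j → ℤ𝟙.𝟙[ j ⊑? m ] ℤ.* rank j) (allFin n)) ≡⟨ sumℤ-map-filter (_⊑? m) rank (allFin n) ⟨
      sumℤ (map rank (below π m))                     ≡⟨ isRank m ⟩
      + ceilDiv (len m ℕ.* a) b                       ∎
      where open ≡-Reasoning

    ∑-rank≡maximalCeilSum : sumℤ (map rank (allFin n)) ≡ + maximalCeilSum a b
    ∑-rank≡maximalCeilSum = begin
      sumℤ (map rank (allFin n))                                            ≡⟨ sumℤ-map-tabulate rank id ⟩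
      ℤΣ.∑[ j < n ] rank j                                                  ≡⟨ ℤ𝟙.∑-regroup Q? unique rank ⟩
      ℤΣ.∑[ m < n ] ℤΣ.∑[ j < n ] (ℤ𝟙.𝟙[ Q? j m ] ℤ.* rank j)              ≡⟨ ℤΣ.sum-cong-≗ factor ⟩
      ℤΣ.∑[ m < n ] (ℤ𝟙.𝟙[ isMaximal? m ] ℤ.* + ceilDiv (len m ℕ.* a) b) ≡⟨ ℤΣ.sum-cong-≗ (λ m → pos-𝟙-* (isMaximal? m) _) ⟨
      ℤΣ.∑[ m < n ] (+ (ℕ𝟙.𝟙[ isMaximal? m ] ℕ.* ceilDiv (len m ℕ.* a) b)) ≡⟨ pos-∑ (λ m → ℕ𝟙.𝟙[ isMaximal? m ] ℕ.* ceilDiv (len m ℕ.* a) b) ⟨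
      + maximalCeilSum a b                                                  ∎
      where
      open ≡-Reasoning
      Q? : ∀ j m → Dec (IsMaximal m × j ⊑ m)
      Q? j m = isMaximal? m ×-dec (j ⊑? m)
      unique : ∀ j → Σ (Fin n) λ m₀ → (IsMaximal m₀ × j ⊑ m₀) × (∀ m → IsMaximal m × j ⊑ m → m ≡ m₀)
      unique j with maximal-above j
      ... | m₀ , max₀ , j⊑m₀ = m₀ , (max₀ , j⊑m₀) , λ m (max , j⊑m) → maximal-unique max max₀ j⊑m j⊑m₀
      factor : ∀ m → ℤΣ.∑[ j < n ] (ℤ𝟙.𝟙[ Q? j m ] ℤ.* rank j)
                     ≡ ℤ𝟙.𝟙[ isMaximal? m ] ℤ.* + ceilDiv (len m ℕ.* a) b
      factor m = begin
        ℤΣ.∑[ j < n ] (ℤ𝟙.𝟙[ Q? j m ] ℤ.* rank j)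
          ≡⟨ ℤΣ.sum-cong-≗ {n} (λ j → trans (cong (ℤ._* rank j) (ℤ𝟙.𝟙-×-dec (isMaximal? m) (j ⊑? m)))
                                        (ℤₚ.*-assoc ℤ𝟙.𝟙[ isMaximal? m ] ℤ𝟙.𝟙[ j ⊑? m ] (rank j))) ⟩
        ℤΣ.∑[ j < n ] (ℤ𝟙.𝟙[ isMaximal? m ] ℤ.* (ℤ𝟙.𝟙[ j ⊑? m ] ℤ.* rank j))
          ≡⟨ ℤΣ.*-distribˡ-sum ℤ𝟙.𝟙[ isMaximal? m ] (λ j → ℤ𝟙.𝟙[ j ⊑? m ] ℤ.* rank j) ⟨
        ℤ𝟙.𝟙[ isMaximal? m ] ℤ.* ℤΣ.∑[ j < n ] (ℤ𝟙.𝟙[ j ⊑? m ] ℤ.* rank j)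
          ≡⟨ cong (ℤ._*_ (ℤ𝟙.𝟙[ isMaximal? m ])) (∑-rank-below m) ⟩
        ℤ𝟙.𝟙[ isMaximal? m ] ℤ.* + ceilDiv (len m ℕ.* a) b ∎

lemma3p13 : (a b : ℕ) → 0 < a → a < b → Coprime a b →
    (π : List Block) → IsNCPartition (b ∸ 1) π →
    (rank : Fin (length π) → ℤ) → IsRank a b π rank →
    sumℤ (map rank (allFin (length π))) ≥ + a
lemma3p13 a (suc d) _ (s≤s a≤d) _ π isNC rank isRank = begin
  + a                                  ≤⟨ ℤ.+≤+ (a≤d⇒d*a≤t*[1+d]⇒a≤t a≤d (d*a≤maximalCeilSum*[1+d] a)) ⟩
  + maximalCeilSum a (suc d)           ≡⟨ ∑-rank≡maximalCeilSum a (suc d) rank isRank ⟨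
  sumℤ (map rank (allFin (length π)))  ∎
  where
  open NoncrossingPartition isNC
  open ℤₚ.≤-Reasoning
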